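{- Let $k\ge 2$ and let $r = r_{k-1}(K^{(k-1)}_k, \dots, K^{(k-1)}_k)$ be the $k$-color Ramsey number, i.e. the least $r$ such that every coloring of the $(k-1)$-subsets of an $r$-element set with $k$ colors contains a $k$-element set all of whose $(k-1)$-subsets have the same color. Then (for every $n$ and every outcome of the random coloring) $A^{(k)}_n$ contains no copy of $K^{(k)}_r$.
   Context: For $k\ge2$, $A^{(k)}_n$ is the random $k$-graph on an $n$-element vertex set $V$ obtained by choosing a coloring $f:\binom{V}{k-1}\to\{0,\dots,k-1\}$ (uniformly at random) and letting $E\in\binom{V}{k}$ be an edge iff $\sum_{T\subseteq E,|T|=k-1}f(T)\not\equiv0\pmod k$. $K^{(k)}_r$ is the complete $k$-graph on $r$ vertices; a copy of it in $H$ is a set of $r$ vertices all of whose $k$-subsets are edges. -}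

module Defs where

open import Data.Nat using (ℕ; zero; suc; _+_; _∸_; _<_)
open import Data.Nat.Divisibility using (_∣_)
open import Data.Fin using (Fin; toℕ)
open import Data.Fin.Subset using (Subset; inside; outside; _⊆_; ∣_∣)
open import Data.Fin.Subset.Properties using (_⊆?_)
open import Data.Vec using ([]; _∷_)
open import Data.List using (List; []; _∷_; map; _++_; filter)
open import Data.Nat.ListAction using (sum)
open import Data.Product using (Σ; _×_; ∃)
open import Relation.Nullary using (¬_; Dec)
open import Relation.Nullary.Decidable using (_×-dec_)
open import Relation.Binary.PropositionalEquality using (_≡_)
import Data.Nat as ℕ

allSubsets : (n : ℕ) → List (Subset n)
allSubsets zero = [] ∷ []
allSubsets (suc n) = map (inside ∷_) (allSubsets n) ++ map (outside ∷_) (allSubsets n)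

-- a k-colouring of the (k-1)-subsets of Fin n (values on other subsets are ignored)
Coloring : ℕ → ℕ → Set
Coloring k n = Subset n → Fin k

facets : {n : ℕ} (k : ℕ) → Subset n → List (Subset n)
facets {n} k E = filter (λ T → (T ⊆? E) ×-dec (∣ T ∣ ℕ.≟ (k ∸ 1))) (allSubsets n)

-- E (with |E| = k) is an edge of A^(k)_n(f) iff the sum of f over the
-- (k-1)-subsets of E is not ≡ 0 mod k
IsEdge : {k n : ℕ} → Coloring k n → Subset n → Set
IsEdge {k} f E = ∣ E ∣ ≡ k × ¬ (k ∣ sum (map (λ T → toℕ (f T)) (facets k E)))

HasClique : {k n : ℕ} → Coloring k n → ℕ → Set
HasClique {k} {n} f r =
  Σ (Subset n) λ S → ∣ S ∣ ≡ r × (∀ (E : Subset n) → E ⊆ S → ∣ E ∣ ≡ k → IsEdge f E)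

RamseyProp : ℕ → ℕ → Set
RamseyProp k r =
  ∀ (c : Coloring k r) → Σ (Subset r) λ S → ∣ S ∣ ≡ k ×
    ∃ λ (i : Fin k) → ∀ (T : Subset r) → T ⊆ S → ∣ T ∣ ≡ k ∸ 1 → c T ≡ i

IsRamseyNumber : ℕ → ℕ → Set
IsRamseyNumber k r = RamseyProp k r × (∀ r' → r' < r → ¬ RamseyProp k r')

module Submission where

-- Let S be an r-set all of whose k-subsets are edges.  Restricting f to the
-- (k-1)-subsets of S gives a k-colouring of the (k-1)-subsets of an r-set, so
-- the Ramsey property yields a k-set E ⊆ S all of whose (k-1)-subsets (its
-- facets) have one colour i.  A k-set has exactly k facets, so the facet sum of
-- E is k·i, which is divisible by k: E is not an edge, contradicting E ⊆ S.

open import Defs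
open import Data.Nat using (ℕ; _≤_; zero; suc; _+_; _*_; _∸_)
open import Data.Nat.Properties using (m+n∸n≡m; n≤1+n)
open import Data.Nat.Combinatorics using (_C_; nCk≡nC[n∸k]; nC1≡n; nCk+nC[k+1]≡[n+1]C[k+1])
open import Data.Nat.Divisibility using (_∣_; m∣m*n)
open import Data.Nat.ListAction using (sum)
open import Data.Bool using (Bool)
open import Data.Empty using (⊥-elim)
open import Data.List using (List; []; _∷_; map; _++_; filter; length)
open import Data.List.Properties using (filter-++; filter-≐; filter-none; length-++)
open import Data.List.Relation.Unary.All as All using (All; []; _∷_)
open import Data.List.Relation.Unary.All.Properties using (all-filter)
open import Data.Fin using (Fin; toℕ)
open import Data.Fin.Subset using (Subset; inside; outside; _⊆_; ∣_∣)
open import Data.Fin.Subset.Properties using (_⊆?_; drop-∷-⊆; out⊆; in⊆in)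
open import Data.Vec using ([]; _∷_; here; there)
open import Data.Product using (Σ; _×_; _,_; ∃)
open import Function using (_∘_)
open import Relation.Nullary using (¬_; yes; no)
open import Relation.Nullary.Decidable using (_×-dec_)
open import Relation.Unary using (Decidable)
open import Relation.Binary.PropositionalEquality using (_≡_; refl; sym; trans; cong; cong₂; subst; module ≡-Reasoning)
import Data.Nat as ℕ

open ≡-Reasoning

IsSubsetOfSize : {n : ℕ} → Subset n → ℕ → Subset n → Set
IsSubsetOfSize E m T = T ⊆ E × ∣ T ∣ ≡ m

subsetOfSize? : {n : ℕ} (E : Subset n) (m : ℕ) → Decidable (IsSubsetOfSize E m)
subsetOfSize? E m T = (T ⊆? E) ×-dec (∣ T ∣ ℕ.≟ m)

length-filter-map : {A B : Set} {P : B → Set} (P? : Decidable P) (g : A → B) (xs : List A) →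
  length (filter P? (map g xs)) ≡ length (filter (P? ∘ g) xs)
length-filter-map P? g [] = refl
length-filter-map P? g (x ∷ xs) with P? (g x)
... | yes _ = cong suc (length-filter-map P? g xs)
... | no _  = length-filter-map P? g xs

inside⊈outside : {n : ℕ} {T E : Subset n} → ¬ (inside ∷ T ⊆ outside ∷ E)
inside⊈outside T⊆E with T⊆E here
... | ()

-- The enumeration allSubsets n lists exactly (|E| choose m) m-subsets of E.
-- Splitting on the first coordinate of E gives Pascal's rule.
count-subsets-of-size : ∀ n (E : Subset n) m →
  length (filter (subsetOfSize? E m) (allSubsets n)) ≡ ∣ E ∣ C m
count-subsets-of-size zero [] zero = refl
count-subsets-of-size zero [] (suc m) = refl
count-subsets-of-size (suc n) (x ∷ E) m = begin
  length (filter P? (map (inside ∷_) A ++ map (outside ∷_) A))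
    ≡⟨ cong length (filter-++ P? (map (inside ∷_) A) (map (outside ∷_) A)) ⟩
  length (filter P? (map (inside ∷_) A) ++ filter P? (map (outside ∷_) A))
    ≡⟨ length-++ (filter P? (map (inside ∷_) A)) ⟩
  length (filter P? (map (inside ∷_) A)) + length (filter P? (map (outside ∷_) A))
    ≡⟨ cong₂ _+_ (length-filter-map P? (inside ∷_) A) (length-filter-map P? (outside ∷_) A) ⟩
  length (filter (P? ∘ (inside ∷_)) A) + length (filter (P? ∘ (outside ∷_)) A)
    ≡⟨ cong (length (filter (P? ∘ (inside ∷_)) A) +_) without-first ⟩
  length (filter (P? ∘ (inside ∷_)) A) + ∣ E ∣ C m
    ≡⟨ with-first x m ⟩
  ∣ x ∷ E ∣ C m ∎
  where
  A = allSubsets n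
  P? = subsetOfSize? (x ∷ E) m

  without-first : length (filter (P? ∘ (outside ∷_)) A) ≡ ∣ E ∣ C m
  without-first = trans
    (cong length (filter-≐ (P? ∘ (outside ∷_)) (subsetOfSize? E m)
      ((λ (T⊆E , size) → drop-∷-⊆ T⊆E , size) , (λ (T⊆E , size) → out⊆ T⊆E , size)) A))
    (count-subsets-of-size n E m)

  -- subsets containing the first point: none if it lies outside E or m = 0,
  -- and the (m-1)-subsets of E otherwise
  with-first : ∀ x m → length (filter (subsetOfSize? (x ∷ E) m ∘ (inside ∷_)) A) + ∣ E ∣ C m
                       ≡ ∣ x ∷ E ∣ C m
  with-first outside m = cong (λ l → length l + ∣ E ∣ C m)
    (filter-none (subsetOfSize? (outside ∷ E) m ∘ (inside ∷_))
      (All.universal (λ _ (T⊆E , _) → inside⊈outside T⊆E) A))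
  with-first inside zero = cong (λ l → length l + ∣ E ∣ C 0)
    (filter-none (subsetOfSize? (inside ∷ E) 0 ∘ (inside ∷_))
      (All.universal (λ _ ()) A))
  with-first inside (suc m) = begin
    length (filter (subsetOfSize? (inside ∷ E) (suc m) ∘ (inside ∷_)) A) + ∣ E ∣ C suc m
      ≡⟨ cong (_+ ∣ E ∣ C suc m) (trans
           (cong length (filter-≐ (subsetOfSize? (inside ∷ E) (suc m) ∘ (inside ∷_)) (subsetOfSize? E m)
             ((λ (T⊆E , size) → drop-∷-⊆ T⊆E , cong ℕ.pred size) , (λ (T⊆E , size) → in⊆in T⊆E , cong suc size)) A))
           (count-subsets-of-size n E m)) ⟩
    ∣ E ∣ C m + ∣ E ∣ C suc m
      ≡⟨ nCk+nC[k+1]≡[n+1]C[k+1] ∣ E ∣ m ⟩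
    suc ∣ E ∣ C suc m ∎

[1+j]Cj≡1+j : ∀ j → suc j C j ≡ suc j
[1+j]Cj≡1+j j = begin
  suc j C j           ≡⟨ nCk≡nC[n∸k] (n≤1+n j) ⟩
  suc j C (suc j ∸ j) ≡⟨ cong (suc j C_) (m+n∸n≡m 1 j) ⟩
  suc j C 1           ≡⟨ nC1≡n (suc j) ⟩
  suc j               ∎

sum-map-const : {A : Set} (h : A → ℕ) (c : ℕ) {xs : List A} →
  All (λ x → h x ≡ c) xs → sum (map h xs) ≡ length xs * c
sum-map-const h c [] = refl
sum-map-const h c (hx≡c ∷ rest) = cong₂ _+_ hx≡c (sum-map-const h c rest)

-- If every facet of E has colour i, the facet sum is k·i, so E is no edge.
monochromatic⇒non-edge : ∀ {j n} (f : Coloring (suc j) n) (E : Subset n) (i : Fin (suc j)) →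
  (∀ T → T ⊆ E → ∣ T ∣ ≡ j → f T ≡ i) → ¬ IsEdge f E
monochromatic⇒non-edge {j} {n} f E i mono (∣E∣≡k , ¬k∣facet-sum) =
  ¬k∣facet-sum (subst (k ∣_) (sym facet-sum) (m∣m*n (toℕ i)))
  where
  k = suc j

  facet-count : length (facets k E) ≡ k
  facet-count = begin
    length (facets k E) ≡⟨ count-subsets-of-size n E j ⟩
    ∣ E ∣ C j           ≡⟨ cong (_C j) ∣E∣≡k ⟩
    suc j C j           ≡⟨ [1+j]Cj≡1+j j ⟩
    k                   ∎

  facet-colours : All (λ T → toℕ (f T) ≡ toℕ i) (facets k E)
  facet-colours = All.map (λ (T⊆E , size) → cong toℕ (mono _ T⊆E size))
                          (all-filter (subsetOfSize? E j) (allSubsets n))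

  facet-sum : sum (map (λ T → toℕ (f T)) (facets k E)) ≡ k * toℕ i
  facet-sum = trans (sum-map-const (λ T → toℕ (f T)) (toℕ i) facet-colours)
                    (cong (_* toℕ i) facet-count)

-- S ⊆ Fin n viewed as the |S|-element set: embed S T is the image of
-- T ⊆ Fin |S| under the order-preserving bijection Fin |S| ≅ S.
embed : {n : ℕ} (S : Subset n) → Subset ∣ S ∣ → Subset n
embed [] T = []
embed (inside ∷ S) (t ∷ T) = t ∷ embed S T
embed (outside ∷ S) T = outside ∷ embed S T

∣embed∣ : {n : ℕ} (S : Subset n) (T : Subset ∣ S ∣) → ∣ embed S T ∣ ≡ ∣ T ∣
∣embed∣ [] [] = refl
∣embed∣ (inside ∷ S) (inside ∷ T) = cong suc (∣embed∣ S T)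
∣embed∣ (inside ∷ S) (outside ∷ T) = ∣embed∣ S T
∣embed∣ (outside ∷ S) T = ∣embed∣ S T

embed⊆ : {n : ℕ} (S : Subset n) (T : Subset ∣ S ∣) → embed S T ⊆ S
embed⊆ (inside ∷ S) (t ∷ T) here = here
embed⊆ (inside ∷ S) (t ∷ T) (there x∈T) = there (embed⊆ S T x∈T)
embed⊆ (outside ∷ S) T (there x∈T) = there (embed⊆ S T x∈T)

∷⊆∷ : {n m : ℕ} {s t : Bool} {p q : Subset n} {p' q' : Subset m} →
  s ∷ p ⊆ t ∷ q → p' ⊆ q' → s ∷ p' ⊆ t ∷ q'
∷⊆∷ head⊆ _ here with head⊆ here
... | here = here
∷⊆∷ _ tail⊆ (there x∈p') = there (tail⊆ x∈p')

⊆embed⇒embed : {n : ℕ} (S : Subset n) (U : Subset ∣ S ∣) (T : Subset n) → T ⊆ embed S U →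
  Σ (Subset ∣ S ∣) λ T' → embed S T' ≡ T × T' ⊆ U
⊆embed⇒embed [] [] [] _ = [] , refl , λ ()
⊆embed⇒embed (inside ∷ S) (u ∷ U) (t ∷ T) T⊆E with ⊆embed⇒embed S U T (drop-∷-⊆ T⊆E)
... | T' , refl , T'⊆U = t ∷ T' , refl , ∷⊆∷ T⊆E T'⊆U
⊆embed⇒embed (outside ∷ S) U (inside ∷ T) T⊆E = ⊥-elim (inside⊈outside T⊆E)
⊆embed⇒embed (outside ∷ S) U (outside ∷ T) T⊆E with ⊆embed⇒embed S U T (drop-∷-⊆ T⊆E)
... | T' , refl , T'⊆U = T' , refl , T'⊆U

ramsey-inside : ∀ {k r n} → RamseyProp k r → (f : Coloring k n) (S : Subset n) → ∣ S ∣ ≡ r →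
  Σ (Subset n) λ E → E ⊆ S × ∣ E ∣ ≡ k ×
    ∃ λ (i : Fin k) → ∀ T → T ⊆ E → ∣ T ∣ ≡ k ∸ 1 → f T ≡ i
ramsey-inside {k} ramsey f S refl with ramsey (f ∘ embed S)
... | U , ∣U∣≡k , i , mono =
  embed S U , embed⊆ S U , trans (∣embed∣ S U) ∣U∣≡k , i , facet-colour
  where
  facet-colour : ∀ T → T ⊆ embed S U → ∣ T ∣ ≡ k ∸ 1 → f T ≡ i
  facet-colour T T⊆E size with ⊆embed⇒embed S U T T⊆E
  ... | T' , refl , T'⊆U = mono T' T'⊆U (trans (sym (∣embed∣ S T')) size)

lemma21 : ∀ (k : ℕ) → 2 ≤ k → ∀ (r : ℕ) → IsRamseyNumber k r →
    ∀ (n : ℕ) (f : Coloring k n) → ¬ HasClique f r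
lemma21 (suc j) _ r (ramsey , _) n f (S , ∣S∣≡r , clique)
  with ramsey-inside ramsey f S ∣S∣≡r
... | E , E⊆S , ∣E∣≡k , i , mono =
  monochromatic⇒non-edge f E i mono (clique E E⊆S ∣E∣≡k)
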